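{- If a connected graph $G$ has blocks $B_1,B_2,\ldots,B_r$, then $mvd(G)=\left(\sum_{i=1}^{r} mvd(B_i)\right)-r+1$.
   Context: A block of $G$ is a maximal connected subgraph without a cut-vertex. For a vertex-coloring of $G$ (adjacent vertices may share colors), a vertex set is monochromatic if all its vertices have the same color; for distinct $x,y$, an $x$-$y$ vertex cut is a set $D\subseteq V(G)\setminus\{x,y\}$ with $x,y$ in different components of $G-D$. A coloring is an MVD-coloring if every two nonadjacent vertices $x,y$ have a monochromatic $x$-$y$ vertex cut. $mvd(G)$ is the maximum number of colors used by an MVD-coloring of $G$, with the convention $mvd(K_n)=n$. -}

module Defs where

open import Data.Nat using (ℕ; _≤_)
open import Data.Fin using (Fin)
open import Data.Fin.Subset using (Subset; _∈_; _∉_; _⊆_; _⊂_; _─_; _-_; ⊤)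
open import Data.Product using (Σ; ∃; _×_)
open import Relation.Nullary using (¬_)
open import Relation.Binary.PropositionalEquality using (_≡_; _≢_)

record Graph (n : ℕ) : Set₁ where
  field
    Adj   : Fin n → Fin n → Set
    sym   : ∀ {x y} → Adj x y → Adj y x
    irrefl : ∀ {x} → ¬ Adj x x
open Graph public

module _ {n : ℕ} (G : Graph n) where

  -- y is reachable from x by a path all of whose vertices lie in T
  -- (i.e. x and y lie in the same component of the induced subgraph G[T]).
  data Reach (T : Subset n) (x : Fin n) : Fin n → Set where
    here : x ∈ T → Reach T x x
    step : ∀ {y z} → Reach T x y → Adj G y z → z ∈ T → Reach T x z

  Connected : Subset n → Set
  Connected S = (∃ λ v → v ∈ S) × (∀ x y → x ∈ S → y ∈ S → Reach S x y)

  IsCutVertex : Subset n → Fin n → Set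
  IsCutVertex S v = v ∈ S × ∃ λ x → ∃ λ y →
    x ∈ (S - v) × y ∈ (S - v) × ¬ Reach (S - v) x y

  Biconnected : Subset n → Set
  Biconnected S = Connected S × (∀ v → ¬ IsCutVertex S v)

  -- A block of G: a maximal connected subgraph without a cut-vertex
  -- (maximal subgraphs with this property are induced, so they are
  -- determined by their vertex sets).
  IsBlock : Subset n → Set
  IsBlock S = Biconnected S × (∀ S' → S ⊂ S' → ¬ Biconnected S')

  IsVertexCut : Subset n → Subset n → Fin n → Fin n → Set
  IsVertexCut S D x y = D ⊆ S × x ∉ D × y ∉ D × ¬ Reach (S ─ D) x y

  Monochromatic : {k : ℕ} → (Fin n → Fin k) → Subset n → Set
  Monochromatic {k} c D = ∃ λ (a : Fin k) → ∀ v → v ∈ D → c v ≡ a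

  IsMVDColoring : {k : ℕ} → Subset n → (Fin n → Fin k) → Set
  IsMVDColoring S c = ∀ x y → x ∈ S → y ∈ S → x ≢ y → ¬ Adj G x y →
    ∃ λ D → IsVertexCut S D x y × Monochromatic c D

  UsesAllColors : {k : ℕ} → Subset n → (Fin n → Fin k) → Set
  UsesAllColors S c = ∀ j → ∃ λ v → v ∈ S × c v ≡ j

  -- mvd(G[S]) = m: m is the maximum number of colors used by an
  -- MVD-coloring of G[S].  (For complete G[S] this gives |S|, agreeing
  -- with the convention mvd(K_n) = n.)
  IsMVD : Subset n → ℕ → Set
  IsMVD S m =
    (Σ (Fin n → Fin m) λ c → UsesAllColors S c × IsMVDColoring S c) ×
    (∀ k (c : Fin n → Fin k) → UsesAllColors S c → IsMVDColoring S c → k ≤ m)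

-- Induction on the number of vertices.  If G[S] has no cut-vertex, it is its own only block.
-- Otherwise a cut-vertex v splits S into sides S₁, S₂ with S₁ ∩ S₂ = {v} and no edges between
-- S₁ - v and S₂ - v; every block of G[S] is a block of exactly one side, and
-- mvd(S) + 1 = mvd(S₁) + mvd(S₂).  For ≤, the colour sets an MVD-coloring of G[S] uses on the two
-- sides cover all its colours and share the colour of v, and each is at most the mvd of its side.
-- For ≥, MVD-colorings of the sides with palettes that overlap only in the colour of v glue to one
-- of G[S]: pairs inside a side keep their cuts, and pairs on different sides are separated by {v}.
-- Adjacency is an arbitrary relation, so the existence of mvd and of cut-vertices is classical; it
-- is used under double negation, which the decidable goal equation discharges.

module Submission where

open import Data.Bool using (true)
open import Data.Empty using (⊥-elim)
open import Data.Fin using (Fin; zero; suc; _≟_; _↑ˡ_; _↑ʳ_; splitAt; toℕ)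
open import Data.Fin.Permutation.Components using (transpose; transpose-inverse)
open import Data.Fin.Properties using (any?; pigeonhole; ¬Fin0; splitAt⁻¹-↑ˡ; splitAt⁻¹-↑ʳ)
open import Data.Fin.Subset using (Subset; ⊤; _∈_; _∉_; _⊆_; _⊂_; _─_; _-_; _∪_; _∩_; ⁅_⁆; ∣_∣; inside; outside)
open import Data.Fin.Subset.Properties
  using ( _∈?_; _⊆?_; ⊆⊤; ⊆-antisym; ∣⊤∣≡n; p⊂q⇒∣p∣<∣q∣; p─q⊆p; x∈p∧x∉q⇒x∈p─q; x∈p∧x≢y⇒x∈p-y
        ; x∈p∪q⁺; x∈p∪q⁻; x∈p∩q⁺; x∈p∩q⁻; x∈⁅x⁆; x∈⁅y⁆⇒x≡y; x∈⁅y⁆⇔x≡y; x≢y⇒x∉⁅y⁆ )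
open import Data.List as List using (List; []; _∷_; filter; _++_; map; length)
open import Data.List.Properties using (length-++; length-tabulate; map-++; map-tabulate)
open import Data.List.Relation.Binary.Permutation.Propositional using (_↭_; ↭-refl; ↭-trans; ↭-sym; prep)
open import Data.List.Relation.Binary.Permutation.Propositional.Properties using (shift; ↭-length; map⁺)
open import Data.List.Relation.Unary.All as All using (All; []; _∷_)
import Data.List.Relation.Unary.All.Properties as All
open import Data.List.Relation.Unary.AllPairs as AllPairs using (AllPairs)
import Data.List.Relation.Unary.AllPairs.Properties as AllPairs
open import Data.List.Relation.Unary.Any using (Any)
import Data.List.Relation.Unary.Any.Properties as Any
open import Data.Nat using (ℕ; zero; suc; z≤n; s≤s; _+_; _≤_; _<_; _≤?_) renaming (_≟_ to _≟ℕ_)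
open import Data.Nat.Induction using (<-wellFounded)
import Data.Nat.ListAction as ListAction
open import Data.Nat.ListAction.Properties using (sum-↭; sum-++)
open import Data.Nat.Properties
  using ( module ≤-Reasoning; +-comm; +-suc; +-identityʳ; +-cancelʳ-≡; +-monoʳ-≤; +-mono-≤
        ; ≤-reflexive; ≤-trans; ≤-antisym; ≰⇒>; <⇒≢; m≤n⇒m≤1+n )
open import Data.Nat.Tactic.RingSolver using (solve)
open import Data.Product as Product using (Σ; ∃; _×_; _,_; proj₁; proj₂)
open import Data.Sum as Sum using (_⊎_; inj₁; inj₂)
open import Data.Vec using ([]; _∷_; here; there; sum; tabulate)
open import Data.Vec.Properties using ([]=⇒lookup; lookup⇒[]=; lookup∘tabulate)
open import Effect.Monad using (RawMonad)
open import Function using (_∘_)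
open import Function.Bundles using (Equivalence)
open import Induction.WellFounded using (Acc; acc)
open import Level using (0ℓ)
open import Relation.Binary.PropositionalEquality as ≡ using (_≡_; _≢_; refl; trans; cong; cong₂; subst; subst₂)
open import Relation.Nullary using (¬_; Dec; yes; no; does; contradiction)
open import Relation.Nullary.Decidable using (_×-dec_; dec-true; dec-false; decidable-stable; ¬¬-excluded-middle)
open import Relation.Nullary.Negation using (DoubleNegation; ¬¬-Monad)
open import Relation.Unary using (Pred; Decidable)
open import Relation.Unary.Properties using (∁?)

open import Defs

open RawMonad (¬¬-Monad {0ℓ})

¬¬-decide-all : ∀ {n} (P : Fin n → Set) → DoubleNegation (∀ i → Dec (P i))
¬¬-decide-all {zero} P = pure λ ()
¬¬-decide-all {suc n} P = do
  P₀? ← ¬¬-excluded-middle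
  Pₛ? ← ¬¬-decide-all (P ∘ suc)
  pure λ where
    zero → P₀?
    (suc i) → Pₛ? i

Maximum : (ℕ → Set) → ℕ → Set
Maximum P m = P m × (∀ k → P k → k ≤ m)

¬¬-maximum : ∀ {P : ℕ → Set} d {j} → P j → (∀ k → P k → k ≤ j + d) →
  DoubleNegation (∃ (Maximum P))
¬¬-maximum zero {j} Pj bounded =
  pure (j , Pj , λ k Pk → subst (k ≤_) (+-identityʳ j) (bounded k Pk))
¬¬-maximum {P} (suc d) {j} Pj bounded = do
  yes bounded′ ← ¬¬-excluded-middle
    where no unbounded → do
      k , Pk , k≰ ← larger-witness unbounded
      pure (k , Pk , λ i Pi → ≤-trans (bounded i Pi) (subst (_≤ k) (≡.sym (+-suc j d)) (≰⇒> k≰)))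
  ¬¬-maximum d Pj bounded′
  where
  larger-witness : ¬ (∀ k → P k → k ≤ j + d) → DoubleNegation (∃ λ k → P k × ¬ k ≤ j + d)
  larger-witness unbounded no-witness = unbounded λ k Pk →
    decidable-stable (k ≤? j + d) λ k≰ → no-witness (k , Pk , k≰)

subset : ∀ {n ℓ} {P : Pred (Fin n) ℓ} → Decidable P → Subset n
subset P? = tabulate (does ∘ P?)

∈-subset⁺ : ∀ {n ℓ} {P : Pred (Fin n) ℓ} (P? : Decidable P) {x} → P x → x ∈ subset P?
∈-subset⁺ P? {x} Px = lookup⇒[]= x _ (trans (lookup∘tabulate _ x) (dec-true (P? x) Px))

∈-subset⁻ : ∀ {n ℓ} {P : Pred (Fin n) ℓ} (P? : Decidable P) {x} → x ∈ subset P? → P x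
∈-subset⁻ P? {x} x∈ = decidable-stable (P? x) λ ¬Px →
  contradiction (trans (≡.sym ([]=⇒lookup x∈)) (trans (lookup∘tabulate _ x) (dec-false (P? x) ¬Px))) λ ()

x∈p─q⇒x∉q : ∀ {n} (p q : Subset n) {x} → x ∈ p ─ q → x ∉ q
x∈p─q⇒x∉q (true ∷ p) (outside ∷ q) here ()
x∈p─q⇒x∉q (_ ∷ p) (_ ∷ q) (there x∈p─q) (there x∈q) = x∈p─q⇒x∉q p q x∈p─q x∈q

∣p∪q∣+∣p∩q∣≡∣p∣+∣q∣ : ∀ {n} (p q : Subset n) → ∣ p ∪ q ∣ + ∣ p ∩ q ∣ ≡ ∣ p ∣ + ∣ q ∣
∣p∪q∣+∣p∩q∣≡∣p∣+∣q∣ [] [] = refl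
∣p∪q∣+∣p∩q∣≡∣p∣+∣q∣ (inside ∷ p) (inside ∷ q) =
  cong suc (trans (+-suc _ _) (trans (cong suc (∣p∪q∣+∣p∩q∣≡∣p∣+∣q∣ p q)) (≡.sym (+-suc _ _))))
∣p∪q∣+∣p∩q∣≡∣p∣+∣q∣ (inside ∷ p) (outside ∷ q) = cong suc (∣p∪q∣+∣p∩q∣≡∣p∣+∣q∣ p q)
∣p∪q∣+∣p∩q∣≡∣p∣+∣q∣ (outside ∷ p) (inside ∷ q) =
  trans (cong suc (∣p∪q∣+∣p∩q∣≡∣p∣+∣q∣ p q)) (≡.sym (+-suc _ _))
∣p∪q∣+∣p∩q∣≡∣p∣+∣q∣ (outside ∷ p) (outside ∷ q) = ∣p∪q∣+∣p∩q∣≡∣p∣+∣q∣ p q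

x∈p⇒0<∣p∣ : ∀ {n} {p : Subset n} {x} → x ∈ p → 0 < ∣ p ∣
x∈p⇒0<∣p∣ {p = inside ∷ _} _ = s≤s z≤n
x∈p⇒0<∣p∣ {p = outside ∷ _} (there x∈p) = x∈p⇒0<∣p∣ x∈p

rank : ∀ {k} (A : Subset k) {j} → j ∈ A → Fin ∣ A ∣
rank (inside ∷ A) here = zero
rank (inside ∷ A) (there j∈A) = suc (rank A j∈A)
rank (outside ∷ A) (there j∈A) = rank A j∈A

rank-irrelevant : ∀ {k} (A : Subset k) {j} (p q : j ∈ A) → rank A p ≡ rank A q
rank-irrelevant (inside ∷ A) here here = refl
rank-irrelevant (inside ∷ A) (there p) (there q) = cong suc (rank-irrelevant A p q)
rank-irrelevant (outside ∷ A) (there p) (there q) = rank-irrelevant A p q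

rank-surjective : ∀ {k} (A : Subset k) (r : Fin ∣ A ∣) → ∃ λ j → Σ (j ∈ A) λ j∈A → rank A j∈A ≡ r
rank-surjective (inside ∷ A) zero = zero , here , refl
rank-surjective (inside ∷ A) (suc r) with j , j∈A , refl ← rank-surjective A r = suc j , there j∈A , refl
rank-surjective (outside ∷ A) r with j , j∈A , refl ← rank-surjective A r = suc j , there j∈A , refl

compress : ∀ {k} (A : Subset k) {t} → t ∈ A → Fin k → Fin ∣ A ∣
compress A t∈A j with j ∈? A
... | yes j∈A = rank A j∈A
... | no _ = rank A t∈A

compress-surjective : ∀ {k} (A : Subset k) {t} (t∈A : t ∈ A) r →
  ∃ λ j → j ∈ A × compress A t∈A j ≡ r
compress-surjective A t∈A r with j , j∈A , refl ← rank-surjective A r = j , j∈A , compress-rank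
  where
  compress-rank : compress A t∈A j ≡ rank A j∈A
  compress-rank with j ∈? A
  ... | yes j∈A′ = rank-irrelevant A j∈A′ j∈A
  ... | no j∉A = contradiction j∈A j∉A

module _ {a ℓ} {A : Set a} {P : Pred A ℓ} (P? : Decidable P) where

  ↭-filter-∁ : ∀ xs → xs ↭ filter P? xs ++ filter (∁? P?) xs
  ↭-filter-∁ [] = ↭-refl
  ↭-filter-∁ (x ∷ xs) with P? x
  ... | yes Px = prep x (↭-filter-∁ xs)
  ... | no ¬Px =
    ↭-trans (prep x (↭-filter-∁ xs)) (↭-sym (shift x (filter P? xs) (filter (∁? P?) xs)))

  length-filter-∁ : ∀ xs → length (filter P? xs) + length (filter (∁? P?) xs) ≡ length xs
  length-filter-∁ xs = trans (≡.sym (length-++ (filter P? xs))) (≡.sym (↭-length (↭-filter-∁ xs)))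

  sum-map-filter-∁ : (f : A → ℕ) → ∀ xs →
    ListAction.sum (map f (filter P? xs)) + ListAction.sum (map f (filter (∁? P?) xs)) ≡
    ListAction.sum (map f xs)
  sum-map-filter-∁ f xs = begin
    total (filter P? xs) + total (filter (∁? P?) xs)
      ≡⟨ sum-++ (map f (filter P? xs)) _ ⟨
    ListAction.sum (map f (filter P? xs) ++ map f (filter (∁? P?) xs))
      ≡⟨ cong ListAction.sum (map-++ f (filter P? xs) _) ⟨
    total (filter P? xs ++ filter (∁? P?) xs)
      ≡⟨ sum-↭ (map⁺ f (↭-filter-∁ xs)) ⟨
    total xs ∎
    where
    open ≡.≡-Reasoning
    total : List A → ℕ
    total = ListAction.sum ∘ map f

sum-tabulate : ∀ {r} (f : Fin r → ℕ) → ListAction.sum (List.tabulate f) ≡ sum (tabulate f)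
sum-tabulate {zero} f = refl
sum-tabulate {suc r} f = cong (f zero +_) (sum-tabulate (f ∘ suc))

colour-used? : ∀ {n k} (c : Fin n → Fin k) (S′ : Subset n) → Decidable λ j → ∃ λ u → u ∈ S′ × c u ≡ j
colour-used? c S′ j = any? λ u → (u ∈? S′) ×-dec (c u ≟ j)

colours : ∀ {n k} → (Fin n → Fin k) → Subset n → Subset k
colours c S′ = subset (colour-used? c S′)

colours⁺ : ∀ {n k} (c : Fin n → Fin k) {S′ u} → u ∈ S′ → c u ∈ colours c S′
colours⁺ c {S′} u∈S′ = ∈-subset⁺ (colour-used? c S′) (_ , u∈S′ , refl)

colours⁻ : ∀ {n k} {c : Fin n → Fin k} {S′ j} → j ∈ colours c S′ → ∃ λ u → u ∈ S′ × c u ≡ j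
colours⁻ {c = c} {S′} = ∈-subset⁻ (colour-used? c S′)

merge-counts : ∀ m m₁ m₂ l₁ l₂ s₁ s₂ → m + 1 ≡ m₁ + m₂ → m₁ + l₁ ≡ s₁ + 1 → m₂ + l₂ ≡ s₂ + 1 →
  m + (l₁ + l₂) ≡ (s₁ + s₂) + 1
merge-counts m m₁ m₂ l₁ l₂ s₁ s₂ e e₁ e₂ = +-cancelʳ-≡ 1 _ _ (begin
  m + (l₁ + l₂) + 1         ≡⟨ solve (m List.∷ l₁ List.∷ l₂ List.∷ List.[]) ⟩
  (m + 1) + (l₁ + l₂)       ≡⟨ cong (_+ (l₁ + l₂)) e ⟩
  (m₁ + m₂) + (l₁ + l₂)     ≡⟨ solve (m₁ List.∷ m₂ List.∷ l₁ List.∷ l₂ List.∷ List.[]) ⟩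
  (m₁ + l₁) + (m₂ + l₂)     ≡⟨ cong₂ _+_ e₁ e₂ ⟩
  (s₁ + 1) + (s₂ + 1)       ≡⟨ solve (s₁ List.∷ s₂ List.∷ List.[]) ⟩
  (s₁ + s₂) + 1 + 1         ∎)
  where open ≡.≡-Reasoning

transpose-source : ∀ {n} (i j : Fin n) → transpose i j i ≡ j
transpose-source i j with i ≟ i
... | yes _ = refl
... | no i≢i = contradiction refl i≢i

module _ {n : ℕ} (G : Graph n) where

  Reach-target : ∀ {T x y} → Reach G T x y → y ∈ T
  Reach-target (here x∈T) = x∈T
  Reach-target (step _ _ z∈T) = z∈T

  Reach-mono : ∀ {T T′ x y} → T ⊆ T′ → Reach G T x y → Reach G T′ x y
  Reach-mono T⊆T′ (here x∈T) = here (T⊆T′ x∈T)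
  Reach-mono T⊆T′ (step r e z∈T) = step (Reach-mono T⊆T′ r) e (T⊆T′ z∈T)

  Reach-prepend : ∀ {T x y z} → Adj G x y → x ∈ T → Reach G T y z → Reach G T x z
  Reach-prepend e x∈T (here y∈T) = step (here x∈T) e y∈T
  Reach-prepend e x∈T (step r e′ z∈T) = step (Reach-prepend e x∈T r) e′ z∈T

  Reach-sym : ∀ {T x y} → Reach G T x y → Reach G T y x
  Reach-sym (here x∈T) = here x∈T
  Reach-sym (step r e z∈T) = Reach-prepend (sym G e) z∈T (Reach-sym r)

  Reach-trans : ∀ {T x y z} → Reach G T x y → Reach G T y z → Reach G T x z
  Reach-trans r (here _) = r
  Reach-trans r (step r′ e z∈T) = step (Reach-trans r r′) e z∈T

  Reach-first-step : ∀ {T x z} → Reach G T x z → x ≡ z ⊎ ∃ λ w → w ∈ T × Adj G x w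
  Reach-first-step (here _) = inj₁ refl
  Reach-first-step (step {z = z} r e z∈T) with Reach-first-step r
  ... | inj₁ refl = inj₂ (z , z∈T , e)
  ... | inj₂ first = inj₂ first

  AttachedAt : Subset n → Subset n → Fin n → Set
  AttachedAt S S′ v = ∀ {u w} → u ∈ S′ → w ∈ S → w ∉ S′ → Adj G u w → u ≡ v

  module _ {S S′ : Subset n} {v : Fin n} (attached : AttachedAt S S′ v) where

    Reach-exit : ∀ {T a z} → T ⊆ S → a ∈ S′ → Reach G T a z →
      (z ∈ S′ × Reach G (T ∩ S′) a z) ⊎ (z ∉ S′ × Reach G (T ∩ S′) a v)
    Reach-exit T⊆S a∈S′ (here a∈T) = inj₁ (a∈S′ , here (x∈p∩q⁺ (a∈T , a∈S′)))
    Reach-exit {T} {a} {z} T⊆S a∈S′ (step r e z∈T) with Reach-exit T⊆S a∈S′ r | z ∈? S′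
    ... | inj₁ (_ , r′) | yes z∈S′ = inj₁ (z∈S′ , step r′ e (x∈p∩q⁺ (z∈T , z∈S′)))
    ... | inj₁ (y∈S′ , r′) | no z∉S′ =
          inj₂ (z∉S′ , subst (Reach G (T ∩ S′) a) (attached y∈S′ (T⊆S z∈T) z∉S′ e) r′)
    ... | inj₂ (y∉S′ , r′) | yes z∈S′ =
          inj₁ (z∈S′ , subst (Reach G (T ∩ S′) a)
                         (≡.sym (attached z∈S′ (T⊆S (Reach-target r)) y∉S′ (sym G e))) r′)
    ... | inj₂ (_ , r′) | no z∉S′ = inj₂ (z∉S′ , r′)

    Reach-exit-via : ∀ {T a z} → T ⊆ S → a ∈ S′ → z ∉ S′ → Reach G T a z → v ∈ T
    Reach-exit-via T⊆S a∈S′ z∉S′ r with Reach-exit T⊆S a∈S′ r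
    ... | inj₁ (z∈S′ , _) = contradiction z∈S′ z∉S′
    ... | inj₂ (_ , r′) = proj₁ (x∈p∩q⁻ _ _ (Reach-target r′))

    Reach-stay : ∀ {T a z} → T ⊆ S → a ∈ S′ → z ∈ S′ → Reach G T a z → Reach G (T ∩ S′) a z
    Reach-stay T⊆S a∈S′ z∈S′ r with Reach-exit T⊆S a∈S′ r
    ... | inj₁ (_ , r′) = r′
    ... | inj₂ (z∉S′ , _) = contradiction z∈S′ z∉S′

  IsBlockOf : Subset n → Subset n → Set
  IsBlockOf S T = Biconnected G T × T ⊆ S × (∀ S′ → T ⊂ S′ → S′ ⊆ S → ¬ Biconnected G S′)

  Biconnected⇒IsBlockOf-self : ∀ {S} → Biconnected G S → IsBlockOf S S
  Biconnected⇒IsBlockOf-self bic = bic , (λ x∈S → x∈S) , λ where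
    S′ (_ , u , u∈S′ , u∉S) S′⊆S _ → u∉S (S′⊆S u∈S′)

  IsBlockOf-biconnected⇒≡ : ∀ {S T} → Biconnected G S → IsBlockOf S T → T ≡ S
  IsBlockOf-biconnected⇒≡ {S} {T} bicS (_ , T⊆S , maximal) =
    ⊆-antisym T⊆S λ {u} u∈S → decidable-stable (u ∈? T) λ u∉T →
      maximal S (T⊆S , u , u∈S , u∉T) (λ x∈S → x∈S) bicS

  edge : Fin n → Fin n → Subset n
  edge v w = ⁅ v ⁆ ∪ ⁅ w ⁆

  v∈edge : ∀ {v w} → v ∈ edge v w
  v∈edge {v} = x∈p∪q⁺ (inj₁ (x∈⁅x⁆ v))

  w∈edge : ∀ {v w} → w ∈ edge v w
  w∈edge {w = w} = x∈p∪q⁺ (inj₂ (x∈⁅x⁆ w))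

  ∈edge⇒≡⊎≡ : ∀ {v w x} → x ∈ edge v w → x ≡ v ⊎ x ≡ w
  ∈edge⇒≡⊎≡ {v} {w} x∈ with x∈p∪q⁻ ⁅ v ⁆ ⁅ w ⁆ x∈
  ... | inj₁ x∈⁅v⁆ = inj₁ (x∈⁅y⁆⇒x≡y v x∈⁅v⁆)
  ... | inj₂ x∈⁅w⁆ = inj₂ (x∈⁅y⁆⇒x≡y w x∈⁅w⁆)

  edge-biconnected : ∀ {v w} → Adj G v w → Biconnected G (edge v w)
  edge-biconnected {v} {w} e = ((v , v∈edge) , connected) , no-cut-vertex
    where
    connected : ∀ x y → x ∈ edge v w → y ∈ edge v w → Reach G (edge v w) x y
    connected x y x∈ y∈ with ∈edge⇒≡⊎≡ x∈ | ∈edge⇒≡⊎≡ y∈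
    ... | inj₁ refl | inj₁ refl = here x∈
    ... | inj₂ refl | inj₂ refl = here x∈
    ... | inj₁ refl | inj₂ refl = step (here x∈) e y∈
    ... | inj₂ refl | inj₁ refl = step (here x∈) (sym G e) y∈
    no-cut-vertex : ∀ u → ¬ IsCutVertex G (edge v w) u
    no-cut-vertex u (u∈ , x , y , x∈ , y∈ , unreachable) =
      unreachable (subst (Reach G _ x) x≡y (here x∈))
      where
      x≡y : x ≡ y
      x≡y with ∈edge⇒≡⊎≡ (p─q⊆p _ _ x∈) | ∈edge⇒≡⊎≡ (p─q⊆p _ _ y∈)
                | ∈edge⇒≡⊎≡ u∈
      ... | inj₁ refl | inj₁ refl | _ = refl
      ... | inj₂ refl | inj₂ refl | _ = refl
      ... | inj₁ refl | inj₂ refl | inj₁ refl = contradiction (x∈⁅x⁆ x) (x∈p─q⇒x∉q _ _ x∈)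
      ... | inj₁ refl | inj₂ refl | inj₂ refl = contradiction (x∈⁅x⁆ y) (x∈p─q⇒x∉q _ _ y∈)
      ... | inj₂ refl | inj₁ refl | inj₁ refl = contradiction (x∈⁅x⁆ y) (x∈p─q⇒x∉q _ _ y∈)
      ... | inj₂ refl | inj₁ refl | inj₂ refl = contradiction (x∈⁅x⁆ x) (x∈p─q⇒x∉q _ _ x∈)

  IsBlockOf-⊈⁅⁆ : ∀ {S T v w} → v ∈ S → w ∈ S → Adj G v w → IsBlockOf S T → ¬ T ⊆ ⁅ v ⁆
  IsBlockOf-⊈⁅⁆ {S} {T} {v} {w} v∈S w∈S e (_ , _ , maximal) T⊆⁅v⁆ =
    maximal (edge v w) (T⊆edge , w , w∈edge , w∉T) edge⊆S (edge-biconnected e)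
    where
    T⊆edge : T ⊆ edge v w
    T⊆edge t∈T = x∈p∪q⁺ (inj₁ (T⊆⁅v⁆ t∈T))
    w∉T : w ∉ T
    w∉T w∈T = irrefl G (subst (Adj G v) (x∈⁅y⁆⇒x≡y v (T⊆⁅v⁆ w∈T)) e)
    edge⊆S : edge v w ⊆ S
    edge⊆S x∈ with ∈edge⇒≡⊎≡ x∈
    ... | inj₁ refl = v∈S
    ... | inj₂ refl = w∈S

  record Separation (S S₁ S₂ : Subset n) (v : Fin n) : Set where
    field
      connected : Connected G S
      S₁⊆S : S₁ ⊆ S
      S₂⊆S : S₂ ⊆ S
      covers : ∀ {u} → u ∈ S → u ∈ S₁ ⊎ u ∈ S₂
      meet : ∀ {u} → u ∈ S₁ → u ∈ S₂ → u ≡ v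
      v∈S₁ : v ∈ S₁
      v∈S₂ : v ∈ S₂
      attached₁ : AttachedAt S S₁ v
      attached₂ : AttachedAt S S₂ v
      other₁ : ∃ λ w → w ∈ S₁ × w ≢ v
      other₂ : ∃ λ w → w ∈ S₂ × w ≢ v

  Separation-swap : ∀ {S S₁ S₂ v} → Separation S S₁ S₂ v → Separation S S₂ S₁ v
  Separation-swap sep = record
    { connected = connected ; S₁⊆S = S₂⊆S ; S₂⊆S = S₁⊆S
    ; covers = Sum.swap ∘ covers ; meet = λ u∈S₂ u∈S₁ → meet u∈S₁ u∈S₂
    ; v∈S₁ = v∈S₂ ; v∈S₂ = v∈S₁ ; attached₁ = attached₂ ; attached₂ = attached₁
    ; other₁ = other₂ ; other₂ = other₁ }
    where open Separation sep

  module SeparationProperties {S S₁ S₂ : Subset n} {v : Fin n} (sep : Separation S S₁ S₂ v) where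
    open Separation sep

    Reach-v : ∀ {a} → a ∈ S₁ → Reach G S₁ v a
    Reach-v a∈S₁ = Reach-mono (λ x∈ → proj₂ (x∈p∩q⁻ _ _ x∈))
      (Reach-stay attached₁ (λ x∈S → x∈S) v∈S₁ a∈S₁ (proj₂ connected _ _ (S₁⊆S v∈S₁) (S₁⊆S a∈S₁)))

    connected₁ : Connected G S₁
    connected₁ = (v , v∈S₁) , λ a b a∈S₁ b∈S₁ → Reach-trans (Reach-sym (Reach-v a∈S₁)) (Reach-v b∈S₁)

    neighbour₁ : ∃ λ w → w ∈ S₁ × Adj G v w
    neighbour₁ with w , w∈S₁ , w≢v ← other₁ with Reach-first-step (Reach-v w∈S₁)
    ... | inj₁ v≡w = contradiction (≡.sym v≡w) w≢v
    ... | inj₂ first = first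

    ∣S₁∣<∣S∣ : ∣ S₁ ∣ < ∣ S ∣
    ∣S₁∣<∣S∣ with w , w∈S₂ , w≢v ← other₂ =
      p⊂q⇒∣p∣<∣q∣ (S₁⊆S , w , S₂⊆S w∈S₂ , λ w∈S₁ → w≢v (meet w∈S₁ w∈S₂))

    straddle⇒IsCutVertex : ∀ {T a b} → Connected G T → T ⊆ S → a ∈ T → b ∈ T → a ∉ S₂ → b ∉ S₁ →
      IsCutVertex G T v
    straddle⇒IsCutVertex {T} {a} {b} (_ , connectedT) T⊆S a∈T b∈T a∉S₂ b∉S₁ =
      v∈T , a , b , x∈p∧x≢y⇒x∈p-y a∈T a≢v , x∈p∧x≢y⇒x∈p-y b∈T b≢v , v-separates
      where
      a∈S₁ : a ∈ S₁
      a∈S₁ = Sum.[ (λ a∈S₁ → a∈S₁) , (λ a∈S₂ → contradiction a∈S₂ a∉S₂) ] (covers (T⊆S a∈T))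
      a≢v : a ≢ v
      a≢v refl = a∉S₂ v∈S₂
      b≢v : b ≢ v
      b≢v refl = b∉S₁ v∈S₁
      v∈T : v ∈ T
      v∈T = Reach-exit-via attached₁ T⊆S a∈S₁ b∉S₁ (connectedT a b a∈T b∈T)
      v-separates : ¬ Reach G (T - v) a b
      v-separates r = x∈p─q⇒x∉q T ⁅ v ⁆
        (Reach-exit-via attached₁ (λ x∈ → T⊆S (p─q⊆p T ⁅ v ⁆ x∈)) a∈S₁ b∉S₁ r) (x∈⁅x⁆ v)

    ⁅v⁆-IsVertexCut : ∀ {x y} → x ∈ S₁ → x ∉ S₂ → y ∉ S₁ → IsVertexCut G S ⁅ v ⁆ x y
    ⁅v⁆-IsVertexCut x∈S₁ x∉S₂ y∉S₁ =
      ⁅v⁆⊆S , x≢y⇒x∉⁅y⁆ (λ { refl → x∉S₂ v∈S₂ }) , x≢y⇒x∉⁅y⁆ (λ { refl → y∉S₁ v∈S₁ }) ,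
      λ r → x∈p─q⇒x∉q S ⁅ v ⁆ (Reach-exit-via attached₁ (p─q⊆p S ⁅ v ⁆) x∈S₁ y∉S₁ r) (x∈⁅x⁆ v)
      where
      ⁅v⁆⊆S : ⁅ v ⁆ ⊆ S
      ⁅v⁆⊆S u∈⁅v⁆ with refl ← x∈⁅y⁆⇒x≡y v u∈⁅v⁆ = S₁⊆S v∈S₁

    biconnected⇒⊆₁⊎⊆₂ : ∀ {T} → Biconnected G T → T ⊆ S → T ⊆ S₁ ⊎ T ⊆ S₂
    biconnected⇒⊆₁⊎⊆₂ {T} (connectedT , no-cut-vertex) T⊆S with T ⊆? S₂
    ... | yes T⊆S₂ = inj₂ T⊆S₂
    ... | no T⊈S₂ = inj₁ λ {b} b∈T → decidable-stable (b ∈? S₁) λ b∉S₁ →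
          T⊈S₂ λ {a} a∈T → decidable-stable (a ∈? S₂) λ a∉S₂ →
          no-cut-vertex v (straddle⇒IsCutVertex connectedT T⊆S a∈T b∈T a∉S₂ b∉S₁)

    IsBlockOf-restrict₁ : ∀ {T} → IsBlockOf S T → T ⊆ S₁ → IsBlockOf S₁ T
    IsBlockOf-restrict₁ (biconnected , _ , maximal) T⊆S₁ =
      biconnected , T⊆S₁ , λ S′ T⊂S′ S′⊆S₁ → maximal S′ T⊂S′ (S₁⊆S ∘ S′⊆S₁)

    IsBlockOf₁⇒⊈₂ : ∀ {T} → IsBlockOf S₁ T → ¬ T ⊆ S₂
    IsBlockOf₁⇒⊈₂ block T⊆S₂ with w , w∈S₁ , e ← neighbour₁ =
      IsBlockOf-⊈⁅⁆ v∈S₁ w∈S₁ e block λ t∈T →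
        Equivalence.from x∈⁅y⁆⇔x≡y (meet (proj₁ (proj₂ block) t∈T) (T⊆S₂ t∈T))

    IsBlockOf-extend₁ : ∀ {T} → IsBlockOf S₁ T → IsBlockOf S T
    IsBlockOf-extend₁ {T} block@(biconnected , T⊆S₁ , maximal) = biconnected , S₁⊆S ∘ T⊆S₁ , maximal′
      where
      maximal′ : ∀ S′ → T ⊂ S′ → S′ ⊆ S → ¬ Biconnected G S′
      maximal′ S′ T⊂S′ S′⊆S biconnected′ with biconnected⇒⊆₁⊎⊆₂ biconnected′ S′⊆S
      ... | inj₁ S′⊆S₁ = maximal S′ T⊂S′ S′⊆S₁ biconnected′
      ... | inj₂ S′⊆S₂ = IsBlockOf₁⇒⊈₂ block (S′⊆S₂ ∘ proj₁ T⊂S′)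

  module _ {S : Subset n} {v x : Fin n} (connectedS : Connected G S) (v∈S : v ∈ S)
           (x∈S-v : x ∈ S - v) (Reach? : ∀ u → Dec (Reach G (S - v) x u)) where

    private
      C S₁ S₂ : Subset n
      C = subset Reach?
      S₁ = C ∪ ⁅ v ⁆
      S₂ = S ─ C

      S-v⊆S : S - v ⊆ S
      S-v⊆S = p─q⊆p S ⁅ v ⁆

      v∉S-v : v ∉ S - v
      v∉S-v v∈ = x∈p─q⇒x∉q S ⁅ v ⁆ v∈ (x∈⁅x⁆ v)

      C⊆S-v : C ⊆ S - v
      C⊆S-v u∈C = Reach-target (∈-subset⁻ Reach? u∈C)

      ∈S₁⇒∈C⊎≡v : ∀ {u} → u ∈ S₁ → u ∈ C ⊎ u ≡ v
      ∈S₁⇒∈C⊎≡v u∈ = Sum.map₂ (x∈⁅y⁆⇒x≡y v) (x∈p∪q⁻ C ⁅ v ⁆ u∈)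

      C⊆S₁ : C ⊆ S₁
      C⊆S₁ u∈C = x∈p∪q⁺ (inj₁ u∈C)

      v∈S₁ : v ∈ S₁
      v∈S₁ = x∈p∪q⁺ (inj₂ (x∈⁅x⁆ v))

      x∈C : x ∈ C
      x∈C = ∈-subset⁺ Reach? (here x∈S-v)

      ≢v : ∀ {u} → u ∈ S - v → u ≢ v
      ≢v u∈ refl = v∉S-v u∈

    component-separation : ∀ {y} → y ∈ S - v → ¬ Reach G (S - v) x y → Separation S S₁ S₂ v
    component-separation {y} y∈S-v x↛y = record
      { connected = connectedS
      ; S₁⊆S = S₁⊆S ∘ ∈S₁⇒∈C⊎≡v
      ; S₂⊆S = p─q⊆p S C
      ; covers = covers
      ; meet = meet ∘ ∈S₁⇒∈C⊎≡v
      ; v∈S₁ = v∈S₁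
      ; v∈S₂ = x∈p∧x∉q⇒x∈p─q v∈S (v∉S-v ∘ C⊆S-v)
      ; attached₁ = attached₁
      ; attached₂ = attached₂
      ; other₁ = x , C⊆S₁ x∈C , ≢v x∈S-v
      ; other₂ = y , x∈p∧x∉q⇒x∈p─q (S-v⊆S y∈S-v) (x↛y ∘ ∈-subset⁻ Reach?) , ≢v y∈S-v
      }
      where
      S₁⊆S : ∀ {u} → u ∈ C ⊎ u ≡ v → u ∈ S
      S₁⊆S (inj₁ u∈C) = S-v⊆S (C⊆S-v u∈C)
      S₁⊆S (inj₂ refl) = v∈S
      covers : ∀ {u} → u ∈ S → u ∈ S₁ ⊎ u ∈ S₂
      covers {u} u∈S with u ∈? C
      ... | yes u∈C = inj₁ (C⊆S₁ u∈C)
      ... | no u∉C = inj₂ (x∈p∧x∉q⇒x∈p─q u∈S u∉C)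
      meet : ∀ {u} → u ∈ C ⊎ u ≡ v → u ∈ S₂ → u ≡ v
      meet (inj₁ u∈C) u∈S₂ = contradiction u∈C (x∈p─q⇒x∉q S C u∈S₂)
      meet (inj₂ u≡v) _ = u≡v
      attached₁ : AttachedAt S S₁ v
      attached₁ {u} {w} u∈S₁ w∈S w∉S₁ e with ∈S₁⇒∈C⊎≡v u∈S₁
      ... | inj₂ u≡v = u≡v
      ... | inj₁ u∈C = contradiction
        (C⊆S₁ (∈-subset⁺ Reach? (step (∈-subset⁻ Reach? u∈C) e (x∈p∧x≢y⇒x∈p-y w∈S w≢v)))) w∉S₁
        where
        w≢v : w ≢ v
        w≢v refl = w∉S₁ v∈S₁
      attached₂ : AttachedAt S S₂ v
      attached₂ {u} {w} u∈S₂ w∈S w∉S₂ e with u ≟ v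
      ... | yes u≡v = u≡v
      ... | no u≢v = contradiction
        (∈-subset⁺ Reach? (step (∈-subset⁻ Reach? w∈C) (sym G e) (x∈p∧x≢y⇒x∈p-y (p─q⊆p S C u∈S₂) u≢v)))
        (x∈p─q⇒x∉q S C u∈S₂)
        where
        w∈C : w ∈ C
        w∈C = decidable-stable (w ∈? C) (w∉S₂ ∘ x∈p∧x∉q⇒x∈p─q w∈S)

  IsCutVertex⇒¬¬Separation : ∀ {S v} → Connected G S → IsCutVertex G S v →
    DoubleNegation (∃ λ S₁ → ∃ λ S₂ → Separation S S₁ S₂ v)
  IsCutVertex⇒¬¬Separation {S} {v} connectedS (v∈S , x , y , x∈S-v , y∈S-v , x↛y) = do
    Reach? ← ¬¬-decide-all (Reach G (S - v) x)
    pure (_ , _ , component-separation connectedS v∈S x∈S-v Reach? y∈S-v x↛y)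

  IsVertexCut-sym : ∀ {S D x y} → IsVertexCut G S D x y → IsVertexCut G S D y x
  IsVertexCut-sym (D⊆S , x∉D , y∉D , x↛y) = D⊆S , y∉D , x∉D , x↛y ∘ Reach-sym

  IsMVDColoring-restrict : ∀ {S S′ k k′} {c : Fin n → Fin k} → S′ ⊆ S → IsMVDColoring G S c →
    (f : Fin k → Fin k′) → IsMVDColoring G S′ (f ∘ c)
  IsMVDColoring-restrict {S} {S′} S′⊆S mvd f x y x∈ y∈ x≢y x≁y
    with D , (D⊆S , x∉D , y∉D , x↛y) , (a , mono) ← mvd x y (S′⊆S x∈) (S′⊆S y∈) x≢y x≁y =
    D ∩ S′ , (proj₂ ∘ x∈p∩q⁻ D S′ , x∉D ∘ proj₁ ∘ x∈p∩q⁻ D S′ , y∉D ∘ proj₁ ∘ x∈p∩q⁻ D S′ ,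
              x↛y ∘ Reach-mono S′─D∩S′⊆S─D) ,
    (f a , λ u u∈ → cong f (mono u (proj₁ (x∈p∩q⁻ D S′ u∈))))
    where
    S′─D∩S′⊆S─D : S′ ─ (D ∩ S′) ⊆ S ─ D
    S′─D∩S′⊆S─D u∈ = x∈p∧x∉q⇒x∈p─q (S′⊆S (p─q⊆p S′ _ u∈))
      λ u∈D → x∈p─q⇒x∉q S′ _ u∈ (x∈p∩q⁺ (u∈D , p─q⊆p S′ _ u∈))

  HasMonochromaticCut : ∀ {k} → Subset n → (Fin n → Fin k) → Fin n → Fin n → Set
  HasMonochromaticCut S c x y = ∃ λ D → IsVertexCut G S D x y × Monochromatic G c D

  IsMVDColoring-lift : ∀ {S S′ v k k′} → AttachedAt S S′ v → S′ ⊆ S →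
    {c′ : Fin n → Fin k′} → IsMVDColoring G S′ c′ →
    (g : Fin k′ → Fin k) (c : Fin n → Fin k) → (∀ {u} → u ∈ S′ → c u ≡ g (c′ u)) →
    ∀ x y → x ∈ S′ → y ∈ S′ → x ≢ y → ¬ Adj G x y → HasMonochromaticCut S c x y
  IsMVDColoring-lift {S} {S′} attached S′⊆S mvd′ g c agrees x y x∈ y∈ x≢y x≁y
    with D , (D⊆S′ , x∉D , y∉D , x↛y) , (a , mono) ← mvd′ x y x∈ y∈ x≢y x≁y =
    D , (S′⊆S ∘ D⊆S′ , x∉D , y∉D ,
         x↛y ∘ Reach-mono S─D∩S′⊆S′─D ∘ Reach-stay attached (p─q⊆p S D) x∈ y∈) ,
    (g a , λ u u∈D → trans (agrees (D⊆S′ u∈D)) (cong g (mono u u∈D)))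
    where
    S─D∩S′⊆S′─D : (S ─ D) ∩ S′ ⊆ S′ ─ D
    S─D∩S′⊆S′─D u∈ with u∈S─D , u∈S′ ← x∈p∩q⁻ _ _ u∈ = x∈p∧x∉q⇒x∈p─q u∈S′ (x∈p─q⇒x∉q S D u∈S─D)

  IsMVDColoring-const : ∀ {S k} (a : Fin k) → IsMVDColoring G S (λ _ → a)
  IsMVDColoring-const {S} a x y x∈ y∈ x≢y x≁y =
    S ─ edge x y ,
    (p─q⊆p S _ , (λ x∈D → x∈p─q⇒x∉q S _ x∈D v∈edge) , (λ y∈D → x∈p─q⇒x∉q S _ y∈D w∈edge) , x↛y) ,
    (a , λ _ _ → refl)
    where
    remaining⊆edge : S ─ (S ─ edge x y) ⊆ edge x y
    remaining⊆edge {w} w∈ = decidable-stable (w ∈? edge x y)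
      (x∈p─q⇒x∉q S _ w∈ ∘ x∈p∧x∉q⇒x∈p─q (p─q⊆p S _ w∈))
    x↛y : ¬ Reach G (S ─ (S ─ edge x y)) x y
    x↛y r with Reach-first-step r
    ... | inj₁ x≡y = x≢y x≡y
    ... | inj₂ (w , w∈ , e) with ∈edge⇒≡⊎≡ (remaining⊆edge w∈)
    ... | inj₁ refl = irrefl G e
    ... | inj₂ refl = x≁y e

  UsesAllColors⇒≤ : ∀ {S k} {c : Fin n → Fin k} → UsesAllColors G S c → k ≤ n
  UsesAllColors⇒≤ {k = k} {c} uses with k ≤? n
  ... | yes k≤n = k≤n
  ... | no k≰n with i , j , i<j , same ← pigeonhole (≰⇒> k≰n) (proj₁ ∘ uses) =
    contradiction (cong toℕ (trans (≡.sym (proj₂ (proj₂ (uses i))))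
      (trans (cong c same) (proj₂ (proj₂ (uses j)))))) (<⇒≢ i<j)

  IsMVD-unique : ∀ {S m m′} → IsMVD G S m → IsMVD G S m′ → m ≡ m′
  IsMVD-unique ((c , uses , mvd) , maximal) ((c′ , uses′ , mvd′) , maximal′) =
    ≤-antisym (maximal′ _ c uses mvd) (maximal _ c′ uses′ mvd′)

  MVDColoring : Subset n → ℕ → Set
  MVDColoring S k = Σ (Fin n → Fin k) λ c → UsesAllColors G S c × IsMVDColoring G S c

  ¬¬-IsMVD : ∀ {S} → Connected G S → DoubleNegation (∃ (IsMVD G S))
  ¬¬-IsMVD {S} ((s , s∈S) , _) = do
    m , (c , uses , mvd) , maximal ←
      ¬¬-maximum {MVDColoring S} n one-colour λ k (_ , uses , _) → m≤n⇒m≤1+n (UsesAllColors⇒≤ uses)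
    pure (m , (c , uses , mvd) , λ k c uses mvd → maximal k (c , uses , mvd))
    where
    one-colour : MVDColoring S 1
    one-colour = (λ _ → zero) , (λ where zero → s , s∈S , refl) , IsMVDColoring-const zero

  -- Compressing the colours used on S′ to an initial segment gives an MVD-coloring of G[S′].
  ∣colours∣≤mvd : ∀ {S S′ t k m′} {c : Fin n → Fin k} → IsMVDColoring G S c → S′ ⊆ S → t ∈ S′ →
    IsMVD G S′ m′ → ∣ colours c S′ ∣ ≤ m′
  ∣colours∣≤mvd {S′ = S′} {k = k} {c = c} mvd S′⊆S t∈S′ (_ , maximal) =
    maximal _ (f ∘ c) uses (IsMVDColoring-restrict S′⊆S mvd f)
    where
    A : Subset k
    A = colours c S′
    f : Fin k → Fin ∣ A ∣
    f = compress A (colours⁺ c t∈S′)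
    uses : UsesAllColors G S′ (f ∘ c)
    uses r with j , j∈A , refl ← compress-surjective A (colours⁺ c t∈S′) r
               with u , u∈S′ , refl ← colours⁻ {c = c} j∈A = u , u∈S′ , refl

  module _ {S S₁ S₂ : Subset n} {v : Fin n} (sep : Separation S S₁ S₂ v) where
    open Separation sep
    open SeparationProperties sep using (⁅v⁆-IsVertexCut)

    mvd-separation-≤ : ∀ {m m₁ m₂} → IsMVD G S m → IsMVD G S₁ m₁ → IsMVD G S₂ m₂ → m + 1 ≤ m₁ + m₂
    mvd-separation-≤ {m} {m₁} {m₂} ((c , uses , mvd) , _) mvd₁ mvd₂ = begin
      m + 1                     ≡⟨ cong (_+ 1) ∣A₁∪A₂∣≡m ⟨
      ∣ A₁ ∪ A₂ ∣ + 1           ≤⟨ +-monoʳ-≤ ∣ A₁ ∪ A₂ ∣ (x∈p⇒0<∣p∣ colour-of-v∈A₁∩A₂) ⟩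
      ∣ A₁ ∪ A₂ ∣ + ∣ A₁ ∩ A₂ ∣ ≡⟨ ∣p∪q∣+∣p∩q∣≡∣p∣+∣q∣ A₁ A₂ ⟩
      ∣ A₁ ∣ + ∣ A₂ ∣           ≤⟨ +-mono-≤ (∣colours∣≤mvd mvd S₁⊆S v∈S₁ mvd₁)
                                            (∣colours∣≤mvd mvd S₂⊆S v∈S₂ mvd₂) ⟩
      m₁ + m₂                   ∎
      where
      open ≤-Reasoning
      A₁ A₂ : Subset m
      A₁ = colours c S₁
      A₂ = colours c S₂
      colour-of-v∈A₁∩A₂ : c v ∈ A₁ ∩ A₂
      colour-of-v∈A₁∩A₂ = x∈p∩q⁺ (colours⁺ c v∈S₁ , colours⁺ c v∈S₂)
      used : ∀ {j} → (∃ λ u → u ∈ S × c u ≡ j) → j ∈ A₁ ∪ A₂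
      used (u , u∈S , refl) = x∈p∪q⁺ (Sum.map (colours⁺ c) (colours⁺ c) (covers u∈S))
      ∣A₁∪A₂∣≡m : ∣ A₁ ∪ A₂ ∣ ≡ m
      ∣A₁∪A₂∣≡m = trans (cong ∣_∣ (⊆-antisym ⊆⊤ λ {j} _ → used (uses j))) (∣⊤∣≡n m)

    -- The colours of the two sides are made disjoint except that v keeps one common colour:
    -- g₁ first moves the colour of v to 0, which is then sent to g₂'s colour of v.
    module Glue {a b}
      (c₁ : Fin n → Fin (suc a)) (uses₁ : UsesAllColors G S₁ c₁) (mvd₁ : IsMVDColoring G S₁ c₁)
      (c₂ : Fin n → Fin (suc b)) (uses₂ : UsesAllColors G S₂ c₂) (mvd₂ : IsMVDColoring G S₂ c₂) where
      shift₁ : Fin (suc a) → Fin (a + suc b)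
      shift₁ zero = a ↑ʳ c₂ v
      shift₁ (suc k) = k ↑ˡ suc b

      g₁ : Fin (suc a) → Fin (a + suc b)
      g₁ = shift₁ ∘ transpose (c₁ v) zero

      g₂ : Fin (suc b) → Fin (a + suc b)
      g₂ = a ↑ʳ_

      c : Fin n → Fin (a + suc b)
      c u with u ∈? S₁
      ... | yes _ = g₁ (c₁ u)
      ... | no _ = g₂ (c₂ u)

      c-on-S₁ : ∀ {u} → u ∈ S₁ → c u ≡ g₁ (c₁ u)
      c-on-S₁ {u} u∈S₁ with u ∈? S₁
      ... | yes _ = refl
      ... | no u∉S₁ = contradiction u∈S₁ u∉S₁

      c-on-S₂ : ∀ {u} → u ∈ S₂ → c u ≡ g₂ (c₂ u)
      c-on-S₂ {u} u∈S₂ with u ∈? S₁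
      ... | no _ = refl
      ... | yes u∈S₁ with refl ← meet u∈S₁ u∈S₂ = cong shift₁ (transpose-source (c₁ v) zero)

      uses-left : ∀ k → ∃ λ u → u ∈ S × c u ≡ k ↑ˡ suc b
      uses-left k with u , u∈S₁ , c₁u≡ ← uses₁ (transpose zero (c₁ v) (suc k)) =
        u , S₁⊆S u∈S₁ , trans (c-on-S₁ u∈S₁) (cong shift₁ (begin
          transpose (c₁ v) zero (c₁ u)                          ≡⟨ cong (transpose (c₁ v) zero) c₁u≡ ⟩
          transpose (c₁ v) zero (transpose zero (c₁ v) (suc k)) ≡⟨ transpose-inverse (c₁ v) zero ⟩
          suc k                                                 ∎))
        where open ≡.≡-Reasoning

      uses-right : ∀ j → ∃ λ u → u ∈ S × c u ≡ a ↑ʳ j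
      uses-right j with u , u∈S₂ , refl ← uses₂ j = u , S₂⊆S u∈S₂ , c-on-S₂ u∈S₂

      uses : UsesAllColors G S c
      uses z with splitAt a z in split-z
      ... | inj₁ k = Product.map₂ (Product.map₂ (λ c≡ → trans c≡ (splitAt⁻¹-↑ˡ split-z))) (uses-left k)
      ... | inj₂ j = Product.map₂ (Product.map₂ (λ c≡ → trans c≡ (splitAt⁻¹-↑ʳ split-z))) (uses-right j)

      in-S₂ : ∀ {u} → u ∈ S → u ∉ S₁ → u ∈ S₂
      in-S₂ u∈S u∉S₁ = Sum.[ (λ u∈S₁ → contradiction u∈S₁ u∉S₁) , (λ u∈S₂ → u∈S₂) ] (covers u∈S)

      lift₁ : ∀ x y → x ∈ S₁ → y ∈ S₁ → x ≢ y → ¬ Adj G x y → HasMonochromaticCut S c x y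
      lift₁ = IsMVDColoring-lift attached₁ S₁⊆S mvd₁ g₁ c c-on-S₁

      lift₂ : ∀ x y → x ∈ S₂ → y ∈ S₂ → x ≢ y → ¬ Adj G x y → HasMonochromaticCut S c x y
      lift₂ = IsMVDColoring-lift attached₂ S₂⊆S mvd₂ g₂ c c-on-S₂

      ⁅v⁆-monochromatic : Monochromatic G c ⁅ v ⁆
      ⁅v⁆-monochromatic = c v , λ u u∈⁅v⁆ → cong c (x∈⁅y⁆⇒x≡y v u∈⁅v⁆)

      mvd : IsMVDColoring G S c
      mvd x y x∈S y∈S x≢y x≁y with x ∈? S₁ | y ∈? S₁
      ... | yes x∈S₁ | yes y∈S₁ = lift₁ x y x∈S₁ y∈S₁ x≢y x≁y
      ... | no x∉S₁ | no y∉S₁ = lift₂ x y (in-S₂ x∈S x∉S₁) (in-S₂ y∈S y∉S₁) x≢y x≁y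
      ... | yes x∈S₁ | no y∉S₁ with x ∈? S₂
      ...   | yes x∈S₂ = lift₂ x y x∈S₂ (in-S₂ y∈S y∉S₁) x≢y x≁y
      ...   | no x∉S₂ = ⁅ v ⁆ , ⁅v⁆-IsVertexCut x∈S₁ x∉S₂ y∉S₁ , ⁅v⁆-monochromatic
      mvd x y x∈S y∈S x≢y x≁y | no x∉S₁ | yes y∈S₁ with y ∈? S₂
      ...   | yes y∈S₂ = lift₂ x y (in-S₂ x∈S x∉S₁) y∈S₂ x≢y x≁y
      ...   | no y∉S₂ = ⁅ v ⁆ , IsVertexCut-sym (⁅v⁆-IsVertexCut y∈S₁ y∉S₂ x∉S₁) , ⁅v⁆-monochromatic

    mvd-separation-≥ : ∀ {m m₁ m₂} → IsMVD G S m → IsMVD G S₁ m₁ → IsMVD G S₂ m₂ → m₁ + m₂ ≤ m + 1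
    mvd-separation-≥ {m₁ = zero} _ ((c₁ , _) , _) _ = contradiction (c₁ v) ¬Fin0
    mvd-separation-≥ {m₁ = suc _} {zero} _ _ ((c₂ , _) , _) = contradiction (c₂ v) ¬Fin0
    mvd-separation-≥ {m} {suc _} {suc _} (_ , maximal) ((c₁ , uses₁ , mvd₁) , _)
                                                         ((c₂ , uses₂ , mvd₂) , _) =
      ≤-trans (s≤s (maximal _ c uses mvd)) (≤-reflexive (+-comm 1 m))
      where open Glue c₁ uses₁ mvd₁ c₂ uses₂ mvd₂

    mvd-separation : ∀ {m m₁ m₂} → IsMVD G S m → IsMVD G S₁ m₁ → IsMVD G S₂ m₂ → m + 1 ≡ m₁ + m₂
    mvd-separation mvd mvd₁ mvd₂ =
      ≤-antisym (mvd-separation-≤ mvd mvd₁ mvd₂) (mvd-separation-≥ mvd mvd₁ mvd₂)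

  IsBlock⇒IsBlockOf-⊤ : ∀ {T} → IsBlock G T → IsBlockOf ⊤ T
  IsBlock⇒IsBlockOf-⊤ (biconnected , maximal) = biconnected , ⊆⊤ , λ S′ T⊂S′ _ → maximal S′ T⊂S′

  IsBlockOf-⊤⇒IsBlock : ∀ {T} → IsBlockOf ⊤ T → IsBlock G T
  IsBlockOf-⊤⇒IsBlock (biconnected , _ , maximal) = biconnected , λ S′ T⊂S′ → maximal S′ T⊂S′ ⊆⊤

  mvd-total : List (Subset n × ℕ) → ℕ
  mvd-total L = ListAction.sum (map proj₂ L)

  record BlockTable (S : Subset n) (L : List (Subset n × ℕ)) : Set where
    field
      entries : All (λ (T , k) → IsBlockOf S T × IsMVD G T k) L
      distinct : AllPairs (λ e e′ → proj₁ e ≢ proj₁ e′) L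
      complete : ∀ T → IsBlockOf S T → Any (λ e → proj₁ e ≡ T) L
  open BlockTable

  BlockTable-filter : ∀ {S S′ L} {Q : Pred (Subset n) 0ℓ} (Q? : Decidable Q) →
    (∀ {T} → IsBlockOf S T → Q T → IsBlockOf S′ T) →
    (∀ {T} → IsBlockOf S′ T → IsBlockOf S T × Q T) →
    BlockTable S L → BlockTable S′ (filter (Q? ∘ proj₁) L)
  BlockTable-filter {L = L} {Q} Q? restrict extend table = record
    { entries = All.zipWith (λ ((block , mvd) , QT) → restrict block QT , mvd)
                  (All.filter⁺ (Q? ∘ proj₁) (entries table) , All.all-filter (Q? ∘ proj₁) L)
    ; distinct = AllPairs.filter⁺ (Q? ∘ proj₁) (distinct table)
    ; complete = complete′
    }
    where
    complete′ : ∀ T → IsBlockOf _ T → Any (λ e → proj₁ e ≡ T) (filter (Q? ∘ proj₁) L)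
    complete′ T block with block′ , QT ← extend block
                      with found ← complete table T block′
                      with Any.filter⁺ (Q? ∘ proj₁) found
    ... | inj₁ found′ = found′
    ... | inj₂ ¬Q = contradiction (subst Q (≡.sym (Any.lookup-result found)) QT) ¬Q

  BlockTable-separation₁ : ∀ {S S₁ S₂ v L} → Separation S S₁ S₂ v → BlockTable S L →
    BlockTable S₁ (filter ((_⊆? S₁) ∘ proj₁) L)
  BlockTable-separation₁ sep =
    BlockTable-filter (_⊆? _) IsBlockOf-restrict₁ λ block → IsBlockOf-extend₁ block , proj₁ (proj₂ block)
    where open SeparationProperties sep

  BlockTable-separation₂ : ∀ {S S₁ S₂ v L} → Separation S S₁ S₂ v → BlockTable S L →
    BlockTable S₂ (filter (∁? ((_⊆? S₁) ∘ proj₁)) L)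
  BlockTable-separation₂ {S} {S₁} {S₂} sep = BlockTable-filter (∁? (_⊆? S₁)) restrict λ block →
    S₂.IsBlockOf-extend₁ block , S₂.IsBlockOf₁⇒⊈₂ block
    where
    module S₁ = SeparationProperties sep
    module S₂ = SeparationProperties (Separation-swap sep)
    restrict : ∀ {T} → IsBlockOf S T → ¬ T ⊆ S₁ → IsBlockOf S₂ T
    restrict block T⊈S₁ with S₁.biconnected⇒⊆₁⊎⊆₂ (proj₁ block) (proj₁ (proj₂ block))
    ... | inj₁ T⊆S₁ = ⊥-elim (T⊈S₁ T⊆S₁)
    ... | inj₂ T⊆S₂ = S₂.IsBlockOf-restrict₁ block T⊆S₂

  BlockTable-tabulate : ∀ {r} (B : Fin r → Subset n) (k : Fin r → ℕ) →
    (∀ i → IsBlock G (B i)) → (∀ i j → i ≢ j → B i ≢ B j) → (∀ S → IsBlock G S → ∃ λ i → B i ≡ S) →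
    (∀ i → IsMVD G (B i) (k i)) → BlockTable ⊤ (List.tabulate λ i → B i , k i)
  BlockTable-tabulate B k blocks distinct complete mvds = record
    { entries = All.tabulate⁺ λ i → IsBlock⇒IsBlockOf-⊤ (blocks i) , mvds i
    ; distinct = AllPairs.tabulate⁺ λ {i} {j} → distinct i j
    ; complete = λ T block →
        let i , Bi≡T = complete T (IsBlockOf-⊤⇒IsBlock block) in Any.tabulate⁺ i Bi≡T
    }

  mvd-blocks-biconnected : ∀ {S L m} → Biconnected G S → BlockTable S L → IsMVD G S m →
    m + length L ≡ mvd-total L + 1
  mvd-blocks-biconnected {L = []} biconnected table _
    with () ← complete table _ (Biconnected⇒IsBlockOf-self biconnected)
  mvd-blocks-biconnected {L = (_ , k) ∷ []} biconnected table mvd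
    with (block , mvdT) ∷ [] ← entries table
    with refl ← IsBlockOf-biconnected⇒≡ biconnected block =
    cong (_+ 1) (trans (IsMVD-unique mvd mvdT) (≡.sym (+-identityʳ k)))
  mvd-blocks-biconnected {L = _ ∷ _ ∷ _} biconnected table _
    with (block , _) ∷ (block′ , _) ∷ _ ← entries table | (T≢T′ ∷ _) AllPairs.∷ _ ← distinct table =
    ⊥-elim (T≢T′ (trans (IsBlockOf-biconnected⇒≡ biconnected block)
                        (≡.sym (IsBlockOf-biconnected⇒≡ biconnected block′))))

  MVDBlockFormula : Subset n → Set
  MVDBlockFormula S = ∀ {L m} → BlockTable S L → IsMVD G S m → m + length L ≡ mvd-total L + 1

  mvd-blocks-separation : ∀ {S S₁ S₂ v m₁ m₂} → Separation S S₁ S₂ v →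
    IsMVD G S₁ m₁ → IsMVD G S₂ m₂ → MVDBlockFormula S₁ → MVDBlockFormula S₂ → MVDBlockFormula S
  mvd-blocks-separation {S₁ = S₁} {m₁ = m₁} {m₂} sep mvd₁ mvd₂ formula₁ formula₂ {L} {m} table mvd =
    subst₂ (λ l s → m + l ≡ s + 1) (length-filter-∁ P? L) (sum-map-filter-∁ P? proj₂ L)
      (merge-counts m m₁ m₂ (length L₁) (length L₂) (mvd-total L₁) (mvd-total L₂)
        (mvd-separation sep mvd mvd₁ mvd₂)
        (formula₁ (BlockTable-separation₁ sep table) mvd₁)
        (formula₂ (BlockTable-separation₂ sep table) mvd₂))
    where
    P? : Decidable ((_⊆ S₁) ∘ proj₁)
    P? = (_⊆? S₁) ∘ proj₁
    L₁ L₂ : List (Subset n × ℕ)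
    L₁ = filter P? L
    L₂ = filter (∁? P?) L

  -- The goal is a decidable equation, so the classical steps may be taken under double negation.
  mvd-blocks : ∀ {S} → Acc _<_ ∣ S ∣ → Connected G S → MVDBlockFormula S
  mvd-blocks {S} (acc smaller) connectedS {L} {m} table mvd =
    decidable-stable (m + length L ≟ℕ mvd-total L + 1) do
      yes (v , cut) ← ¬¬-excluded-middle {A = ∃ (IsCutVertex G S)}
        where no no-cut →
                pure (mvd-blocks-biconnected (connectedS , λ v cut → no-cut (v , cut)) table mvd)
      S₁ , S₂ , sep ← IsCutVertex⇒¬¬Separation connectedS cut
      let module S₁ = SeparationProperties sep
          module S₂ = SeparationProperties (Separation-swap sep)
      m₁ , mvd₁ ← ¬¬-IsMVD S₁.connected₁
      m₂ , mvd₂ ← ¬¬-IsMVD S₂.connected₁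
      pure (mvd-blocks-separation sep mvd₁ mvd₂
             (mvd-blocks (smaller S₁.∣S₁∣<∣S∣) S₁.connected₁)
             (mvd-blocks (smaller S₂.∣S₁∣<∣S∣) S₂.connected₁) table mvd)


corollary2p5 : ∀ {n} (G : Graph n) → Connected G ⊤ →
    ∀ r (B : Fin r → Subset n) →
    (∀ i → IsBlock G (B i)) →
    (∀ i j → i ≢ j → B i ≢ B j) →
    (∀ S → IsBlock G S → ∃ λ i → B i ≡ S) →
    ∀ (mvdG : ℕ) (mvdB : Fin r → ℕ) →
    IsMVD G ⊤ mvdG → (∀ i → IsMVD G (B i) (mvdB i)) →
    mvdG + r ≡ sum (tabulate mvdB) + 1
corollary2p5 {n} G connected r B blocks distinct complete mvdG mvdB mvd mvdBlocks =
  subst₂ (λ l s → mvdG + l ≡ s + 1) (length-tabulate entry)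
    (trans (cong ListAction.sum (map-tabulate entry proj₂)) (sum-tabulate mvdB))
    (mvd-blocks G (<-wellFounded ∣ ⊤ {n} ∣) connected
      (BlockTable-tabulate G B mvdB blocks distinct complete mvdBlocks) mvd)
  where
  entry : Fin r → Subset n × ℕ
  entry i = B i , mvdB i
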